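{- There exists a punctual copy $\mathcal{A} = (\mathbb{N}, S^{\mathcal{A}})$ of $\mathcal{S} = (\mathbb{N}, S)$ such that the standard ordering is primitive recursive on $\mathcal{A}$, and whenever $f:\mathbb{N}\to\mathbb{N}$ is a primitive recursive function with $f(x) > 2x$ for all sufficiently large $x$, $f$ is not primitive recursive on $\mathcal{A}$.
   Context: $S$ denotes the successor function on $\mathbb{N}$. A copy of $\mathcal{S}$ is a structure $\mathcal{A} = (\mathbb{N}, S^{\mathcal{A}})$ isomorphic to $(\mathbb{N}, S)$; it is punctual if $S^{\mathcal{A}}$ is primitive recursive. Let $c: (\mathbb{N}, S)\to\mathcal{A}$ be the isomorphism. For $f:\mathbb{N}^k\to\mathbb{N}$, $f^{\mathcal{A}}(x_1,\dots,x_k) = c(f(c^{ -1}(x_1),\dots,c^{ -1}(x_k)))$, and $f$ is primitive recursive on $\mathcal{A}$ if $f^{\mathcal{A}}$ is primitive recursive. For a relation $R$, its image $R^{\mathcal{A}}$ is defined by $R^{\mathcal{A}}(x_1,\dots,x_k) \iff R(c^{ -1}(x_1),\dots,c^{ -1}(x_k))$, and $R$ is primitive recursive on $\mathcal{A}$ if $R^{\mathcal{A}}$ has a primitive recursive characteristic function. -}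

module Defs where

open import Data.Nat using (ℕ; zero; suc; _≤_; _<_; _*_)
open import Data.Fin using (Fin)
open import Data.Vec using (Vec; []; _∷_; lookup)
open import Data.Product using (Σ; ∃; _×_; _,_)
open import Data.Sum using (_⊎_)
open import Relation.Nullary using (¬_)
open import Relation.Binary.PropositionalEquality using (_≡_)
open import Function.Bundles using (_↔_; Inverse)

data PR : ℕ → Set where
  zer  : ∀ {k} → PR k
  succ : PR 1
  proj : ∀ {k} → Fin k → PR k
  comp : ∀ {k m} → PR m → Vec (PR k) m → PR k
  prec : ∀ {k} → PR k → PR (suc (suc k)) → PR (suc k)

mutual
  eval : ∀ {k} → PR k → Vec ℕ k → ℕ
  eval zer xs = 0
  eval succ (x ∷ []) = suc x
  eval (proj i) xs = lookup xs i
  eval (comp f gs) xs = eval f (evalAll gs xs)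
  eval (prec g h) (zero ∷ xs) = eval g xs
  eval (prec g h) (suc n ∷ xs) = eval h (n ∷ eval (prec g h) (n ∷ xs) ∷ xs)

  evalAll : ∀ {k m} → Vec (PR k) m → Vec ℕ k → Vec ℕ m
  evalAll [] xs = []
  evalAll (g ∷ gs) xs = eval g xs ∷ evalAll gs xs

IsPR₁ : (ℕ → ℕ) → Set
IsPR₁ f = Σ (PR 1) λ p → ∀ x → eval p (x ∷ []) ≡ f x

IsPRRel₂ : (ℕ → ℕ → Set) → Set
IsPRRel₂ R = Σ (PR 2) λ p → ∀ x y →
  (R x y × eval p (x ∷ y ∷ []) ≡ 1) ⊎ (¬ R x y × eval p (x ∷ y ∷ []) ≡ 0)

IsIsoToCopy : (ℕ → ℕ) → ℕ ↔ ℕ → Set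
IsIsoToCopy SA c = ∀ n → Inverse.to c (suc n) ≡ SA (Inverse.to c n)

imageFun : ℕ ↔ ℕ → (ℕ → ℕ) → ℕ → ℕ
imageFun c f x = Inverse.to c (f (Inverse.from c x))

imageRel : ℕ ↔ ℕ → (ℕ → ℕ → Set) → ℕ → ℕ → Set
imageRel c R x y = R (Inverse.from c x) (Inverse.from c y)

EventuallyAboveDouble : (ℕ → ℕ) → Set
EventuallyAboveDouble f = ∃ λ N → ∀ x → N ≤ x → 2 * x < f x

-- Stage i of a primitive recursive process performs one step of a stack machine computing
-- Ackermann's function. Phase j begins at stage U j (phaseStart j) by starting the computation of
-- ack j (U j), and ends at the first stage whose stack is empty, so its last stage is at least
-- ack j (U j); still, a stage's phase, the start of that phase and whether the stack is empty
-- are primitive recursive in the stage.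
--
-- The number x is the cell at stage ⌊x/2⌋ on track lsb x. Block j of the copy runs through the
-- cells on track lsb j from stage U (j - 1) to the end of phase j, so the cell at stage i of block
-- j has position i + U j. The successor moves one stage ahead, except that the last cell of
-- block j jumps back to the first cell of block j + 1, at stage U j on the other track. Two
-- elements compare by block, then by stage, so the order is primitive recursive too.
--
-- For even k the first cell of block k + 1 has code 2 U k + 1 and position U k + U (k + 1).
-- If f(x) > 2x, its image under f^A lies beyond position 2 U (k + 1), hence beyond stage
-- U (k + 1) and so above ack k (U k). Every primitive recursive function is below some ack M,
-- so f^A is not primitive recursive. The argument never uses that f itself is primitive recursive.

module Submission where

open import Defs
open import Data.Fin using (Fin; #_)
open import Data.List using (List; []; _∷_; foldl)
open import Data.List.Properties using (≡-dec)
open import Data.Nat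
open import Data.Nat.GeneralisedArithmetic using (fold; fold-+)
open import Data.Nat.Properties
open import Data.Product using (Σ; ∃; _×_; _,_; proj₁; proj₂)
open import Data.Product.Relation.Binary.Lex.Strict using (×-Lex)
open import Data.Sum using (_⊎_; inj₁; inj₂)
open import Data.Vec using (Vec; []; _∷_; lookup; map; head; tail)
open import Function.Bundles using (_↔_; _⇔_; mk↔ₛ′; mk⇔; Equivalence)
open import Relation.Binary.Definitions using (tri<; tri≈; tri>)
open import Relation.Binary.PropositionalEquality
open import Relation.Nullary using (¬_; contradiction; yes; no)
open import Relation.Unary using (Decidable)

-- Ackermann majorisation

mono-≤-from-step : (f : ℕ → ℕ) → (∀ n → f n ≤ f (suc n)) → ∀ {m n} → m ≤ n → f m ≤ f n
mono-≤-from-step f step {n = zero} z≤n = ≤-refl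
mono-≤-from-step f step {n = suc n} m≤1+n with m≤n⇒m<n∨m≡n m≤1+n
... | inj₁ m<1+n = ≤-trans (mono-≤-from-step f step (s≤s⁻¹ m<1+n)) (step n)
... | inj₂ refl = ≤-refl

mono-<-from-step : (f : ℕ → ℕ) → (∀ n → f n < f (suc n)) → ∀ {m n} → m < n → f m < f n
mono-<-from-step f step {m} m<n = <-≤-trans (step m) (mono-≤-from-step f (λ n → <⇒≤ (step n)) m<n)

ack : ℕ → ℕ → ℕ
ack zero n = suc n
ack (suc m) zero = ack m 1
ack (suc m) (suc n) = ack m (ack (suc m) n)

n<ack : ∀ m n → n < ack m n
n<ack zero n = ≤-refl
n<ack (suc m) zero = <-trans z<s (n<ack m 1)
n<ack (suc m) (suc n) = ≤-<-trans (n<ack (suc m) n) (n<ack m _)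

ack-<-suc : ∀ m n → ack m n < ack m (suc n)
ack-<-suc zero n = ≤-refl
ack-<-suc (suc m) n = n<ack m _

ack-monoʳ-≤ : ∀ m {n n′} → n ≤ n′ → ack m n ≤ ack m n′
ack-monoʳ-≤ m = mono-≤-from-step (ack m) (λ n → <⇒≤ (ack-<-suc m n))

ack-monoʳ-< : ∀ m {n n′} → n < n′ → ack m n < ack m n′
ack-monoʳ-< m = mono-<-from-step (ack m) (ack-<-suc m)

ack[m,1+n]≤ack[1+m,n] : ∀ m n → ack m (suc n) ≤ ack (suc m) n
ack[m,1+n]≤ack[1+m,n] m zero = ≤-refl
ack[m,1+n]≤ack[1+m,n] m (suc n) =
  ack-monoʳ-≤ m (≤-trans (n<ack m (suc n)) (ack[m,1+n]≤ack[1+m,n] m n))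

ack-monoˡ-≤ : ∀ {m m′} n → m ≤ m′ → ack m n ≤ ack m′ n
ack-monoˡ-≤ n = mono-≤-from-step (λ m → ack m n)
  (λ m → ≤-trans (<⇒≤ (ack-<-suc m n)) (ack[m,1+n]≤ack[1+m,n] m n))

ack-mono-≤ : ∀ {m m′ n n′} → m ≤ m′ → n ≤ n′ → ack m n ≤ ack m′ n′
ack-mono-≤ {m} {n′ = n′} m≤m′ n≤n′ = ≤-trans (ack-monoʳ-≤ m n≤n′) (ack-monoˡ-≤ n′ m≤m′)

ack-nested : ∀ a b n → ack a (ack b n) < ack (2 + (a ⊔ b)) n
ack-nested a b n = begin-strict
  ack a (ack b n)     ≤⟨ ack-mono-≤ (m≤m⊔n a b) (ack-monoˡ-≤ n (m≤n⊔m a b)) ⟩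
  ack c (ack c n)     <⟨ ack-monoʳ-< c (<-≤-trans (ack-<-suc c n) (ack[m,1+n]≤ack[1+m,n] c n)) ⟩
  ack (suc c) (suc n) ≤⟨ ack[m,1+n]≤ack[1+m,n] (suc c) n ⟩
  ack (2 + c) n       ∎
  where
  open ≤-Reasoning
  c = a ⊔ b

ack-1 : ∀ n → ack 1 n ≡ 2 + n
ack-1 zero = refl
ack-1 (suc n) = cong suc (ack-1 n)

n+n≤ack-2 : ∀ n → n + n ≤ ack 2 n
n+n≤ack-2 zero = z≤n
n+n≤ack-2 (suc n) rewrite ack-1 (ack 2 n) | +-suc n n = s≤s (s≤s (n+n≤ack-2 n))

maxᵥ : ∀ {k} → Vec ℕ k → ℕ
maxᵥ [] = 0
maxᵥ (x ∷ xs) = x ⊔ maxᵥ xs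

lookup≤maxᵥ : ∀ {k} (xs : Vec ℕ k) (i : Fin k) → lookup xs i ≤ maxᵥ xs
lookup≤maxᵥ (x ∷ xs) Fin.zero = m≤m⊔n x _
lookup≤maxᵥ (x ∷ xs) (Fin.suc i) = ≤-trans (lookup≤maxᵥ xs i) (m≤n⊔m x _)

BelowAck : ∀ {k} → ℕ → (Vec ℕ k → ℕ) → Set
BelowAck m f = ∀ xs → f xs < ack m (maxᵥ xs)

belowAck-mono : ∀ {k m m′} {f : Vec ℕ k → ℕ} → m ≤ m′ → BelowAck m f → BelowAck m′ f
belowAck-mono m≤m′ f<ack xs = <-≤-trans (f<ack xs) (ack-monoˡ-≤ _ m≤m′)

prec-belowAck : ∀ {k mg mh} {g : PR k} {h : PR (2 + k)} →
  BelowAck mg (eval g) → BelowAck mh (eval h) → BelowAck (2 + (suc (mg ⊔ mh) ⊔ 2)) (eval (prec g h))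
prec-belowAck {k} {mg} {mh} {g} {h} g<ack h<ack (n ∷ xs) = begin-strict
  eval (prec g h) (n ∷ xs) <⟨ prec<ack n xs ⟩
  ack q (n + maxᵥ xs)      ≤⟨ ack-monoʳ-≤ q (≤-trans (+-mono-≤ (m≤m⊔n n _) (m≤n⊔m n _))
                                                      (n+n≤ack-2 (n ⊔ maxᵥ xs))) ⟩
  ack q (ack 2 (n ⊔ maxᵥ xs)) <⟨ ack-nested q 2 (n ⊔ maxᵥ xs) ⟩
  ack (2 + (q ⊔ 2)) (n ⊔ maxᵥ xs) ∎
  where
  open ≤-Reasoning
  q = suc (mg ⊔ mh)
  prec<ack : ∀ n xs → eval (prec g h) (n ∷ xs) < ack q (n + maxᵥ xs)
  prec<ack zero xs = <-≤-trans (g<ack xs) (ack-monoˡ-≤ _ (m≤n⇒m≤1+n (m≤m⊔n mg mh)))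
  prec<ack (suc n) xs = begin-strict
    eval h (n ∷ r ∷ xs)         <⟨ h<ack (n ∷ r ∷ xs) ⟩
    ack mh (n ⊔ (r ⊔ maxᵥ xs))  ≤⟨ ack-monoˡ-≤ _ (m≤n⊔m mg mh) ⟩
    ack (mg ⊔ mh) (n ⊔ (r ⊔ maxᵥ xs)) <⟨ ack-monoʳ-< (mg ⊔ mh) args<ack ⟩
    ack q (suc n + maxᵥ xs)     ∎
    where
    r = eval (prec g h) (n ∷ xs)
    n+max<ack = n<ack q (n + maxᵥ xs)
    args<ack : n ⊔ (r ⊔ maxᵥ xs) < ack q (n + maxᵥ xs)
    args<ack = ⊔-lub (≤-<-trans (m≤m+n n _) n+max<ack)
                     (⊔-lub (prec<ack n xs) (≤-<-trans (m≤n+m _ n) n+max<ack))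

mutual
  eval-belowAck : ∀ {k} (p : PR k) → ∃ λ m → BelowAck m (eval p)
  eval-belowAck zer = 0 , λ _ → z<s
  eval-belowAck succ = 1 , λ { (x ∷ []) → subst (suc x <_) (sym (ack-1 (x ⊔ 0))) (s≤s (s≤s (m≤m⊔n x 0))) }
  eval-belowAck (proj i) = 0 , λ xs → s≤s (lookup≤maxᵥ xs i)
  eval-belowAck (comp f gs) with eval-belowAck f | evalAll-belowAck gs
  ... | mf , f<ack | mg , gs<ack = 2 + (mf ⊔ mg) , λ xs → begin-strict
    eval f (evalAll gs xs)      <⟨ f<ack (evalAll gs xs) ⟩
    ack mf (maxᵥ (evalAll gs xs)) ≤⟨ ack-monoʳ-≤ mf (<⇒≤ (gs<ack xs)) ⟩
    ack mf (ack mg (maxᵥ xs))   <⟨ ack-nested mf mg _ ⟩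
    ack (2 + (mf ⊔ mg)) (maxᵥ xs) ∎
    where open ≤-Reasoning
  eval-belowAck (prec g h) with eval-belowAck g | eval-belowAck h
  ... | mg , g<ack | mh , h<ack = 2 + (suc (mg ⊔ mh) ⊔ 2) , prec-belowAck {mg = mg} {mh} g<ack h<ack

  evalAll-belowAck : ∀ {k n} (gs : Vec (PR k) n) → ∃ λ m → BelowAck m (λ xs → maxᵥ (evalAll gs xs))
  evalAll-belowAck [] = 0 , λ _ → z<s
  evalAll-belowAck (g ∷ gs) with eval-belowAck g | evalAll-belowAck gs
  ... | m , g<ack | m′ , gs<ack = m ⊔ m′ , λ xs →
    ⊔-lub (belowAck-mono (m≤m⊔n m m′) g<ack xs) (belowAck-mono (m≤n⊔m m m′) gs<ack xs)

-- Primitive recursive functions with their codes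

record PRFun (k : ℕ) : Set where
  constructor prfun
  field
    code : PR k
    fun : Vec ℕ k → ℕ
    eval-code : ∀ xs → eval code xs ≡ fun xs
open PRFun public

withFun : ∀ {k} (F : PRFun k) (f : Vec ℕ k → ℕ) → (∀ xs → fun F xs ≡ f xs) → PRFun k
withFun F f F≗f = prfun (code F) f (λ xs → trans (eval-code F xs) (F≗f xs))

isPR₁ : (F : PRFun 1) (f : ℕ → ℕ) → (∀ x → fun F (x ∷ []) ≡ f x) → IsPR₁ f
isPR₁ F f F≗f = code F , λ x → trans (eval-code F (x ∷ [])) (F≗f x)

π : ∀ {k} → Fin k → PRFun k
π i = prfun (proj i) (λ xs → lookup xs i) (λ _ → refl)

constCode : ∀ {k} → ℕ → PR k
constCode zero = zer
constCode (suc n) = comp succ (constCode n ∷ [])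

eval-constCode : ∀ {k} n (xs : Vec ℕ k) → eval (constCode n) xs ≡ n
eval-constCode zero xs = refl
eval-constCode (suc n) xs = cong suc (eval-constCode n xs)

constₚ : ∀ {k} → ℕ → PRFun k
constₚ n = prfun (constCode n) (λ _ → n) (eval-constCode n)

evalAll-map-code : ∀ {k m} (gs : Vec (PRFun k) m) xs → evalAll (map code gs) xs ≡ map (λ g → fun g xs) gs
evalAll-map-code [] xs = refl
evalAll-map-code (g ∷ gs) xs = cong₂ _∷_ (eval-code g xs) (evalAll-map-code gs xs)

_⟨_⟩ : ∀ {k m} → PRFun m → Vec (PRFun k) m → PRFun k
f ⟨ gs ⟩ = prfun (comp (code f) (map code gs)) (λ xs → fun f (map (λ g → fun g xs) gs))
  (λ xs → trans (cong (eval (code f)) (evalAll-map-code gs xs)) (eval-code f _))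

primRec : ∀ {k} (f : ℕ → Vec ℕ k → ℕ) (g : PRFun k) (h : PRFun (2 + k)) →
  (∀ xs → fun g xs ≡ f 0 xs) → (∀ n xs → fun h (n ∷ f n xs ∷ xs) ≡ f (suc n) xs) → PRFun (suc k)
primRec f g h base step = prfun (prec (code g) (code h)) (λ nxs → f (head nxs) (tail nxs)) correct
  where
  correct : ∀ nxs → eval (prec (code g) (code h)) nxs ≡ f (head nxs) (tail nxs)
  correct (zero ∷ xs) = trans (eval-code g xs) (base xs)
  correct (suc n ∷ xs) = begin
    eval (code h) (n ∷ eval (prec (code g) (code h)) (n ∷ xs) ∷ xs)
      ≡⟨ cong (λ r → eval (code h) (n ∷ r ∷ xs)) (correct (n ∷ xs)) ⟩
    eval (code h) (n ∷ f n xs ∷ xs)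
      ≡⟨ eval-code h _ ⟩
    fun h (n ∷ f n xs ∷ xs)
      ≡⟨ step n xs ⟩
    f (suc n) xs
      ∎
    where open ≡-Reasoning

primRec₁ : (f : ℕ → ℕ) (h : PRFun 2) → (∀ n → fun h (n ∷ f n ∷ []) ≡ f (suc n)) → PRFun 1
primRec₁ f h step = primRec (λ n _ → f n) (constₚ (f 0)) h (λ _ → refl) (λ { n [] → step n })

sucₚ : ∀ {k} → PRFun k → PRFun k
sucₚ a = successor ⟨ a ∷ [] ⟩
  where
  successor : PRFun 1
  successor = prfun succ (λ xs → suc (head xs)) (λ { (x ∷ []) → refl })

predₚ : ∀ {k} → PRFun k → PRFun k
predₚ a = predecessor ⟨ a ∷ [] ⟩
  where
  predecessor : PRFun 1
  predecessor = primRec₁ pred (π (# 0)) (λ _ → refl)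

_+ₚ_ : ∀ {k} → PRFun k → PRFun k → PRFun k
a +ₚ b = addition ⟨ a ∷ b ∷ [] ⟩
  where
  addition : PRFun 2
  addition = primRec (λ n ys → n + head ys) (π (# 0)) (sucₚ (π (# 1)))
    (λ { (y ∷ []) → refl }) (λ { n (y ∷ []) → refl })

_∸ₚ_ : ∀ {k} → PRFun k → PRFun k → PRFun k
a ∸ₚ b = flippedMonus ⟨ b ∷ a ∷ [] ⟩
  where
  flippedMonus : PRFun 2
  flippedMonus = primRec (λ n ys → head ys ∸ n) (π (# 0)) (predₚ (π (# 1)))
    (λ { (y ∷ []) → refl }) (λ { n (y ∷ []) → pred[m∸n]≡m∸[1+n] y n })

ifZero : ℕ → ℕ → ℕ → ℕ
ifZero zero a b = a
ifZero (suc _) a b = b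

ifZeroₚ : ∀ {k} → PRFun k → PRFun k → PRFun k → PRFun k
ifZeroₚ c a b = ifZeroFun ⟨ c ∷ a ∷ b ∷ [] ⟩
  where
  ifZeroFun : PRFun 3
  ifZeroFun = primRec (λ n ys → ifZero n (head ys) (lookup ys (# 1))) (π (# 0)) (π (# 3))
    (λ { (a ∷ b ∷ []) → refl }) (λ { n (a ∷ b ∷ []) → refl })

ifZero-suc : ∀ {z w a b} → z ≡ suc w → ifZero z a b ≡ b
ifZero-suc refl = refl

χ≤ : ℕ → ℕ → ℕ
χ≤ m n = ifZero (m ∸ n) 1 0

χ≤ₚ : ∀ {k} → PRFun k → PRFun k → PRFun k
χ≤ₚ a b = ifZeroₚ (a ∸ₚ b) (constₚ 1) (constₚ 0)

χ≤-yes : ∀ {m n} → m ≤ n → χ≤ m n ≡ 1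
χ≤-yes m≤n rewrite m≤n⇒m∸n≡0 m≤n = refl

χ≤-no : ∀ {m n} → n < m → χ≤ m n ≡ 0
χ≤-no {suc m} {zero} _ = refl
χ≤-no {suc m} {suc n} (s≤s n<m) = χ≤-no n<m

-- Cantor pairing

triangle : ℕ → ℕ
triangle zero = 0
triangle (suc n) = triangle n + suc n

-- troot n is the largest s with triangle s ≤ n: it grows exactly when n + 1 reaches the next triangular number.
troot : ℕ → ℕ
troot zero = 0
troot (suc n) = troot n + χ≤ (triangle (suc (troot n))) (suc n)

troot-triangle+ : ∀ s y → y ≤ s → troot (triangle s + y) ≡ s
troot-triangle+ zero zero _ = refl
troot-triangle+ (suc s) zero _ = begin
  troot (triangle (suc s) + 0)                      ≡⟨ cong troot (trans (+-identityʳ _) (+-suc (triangle s) s)) ⟩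
  troot (suc (triangle s + s))                      ≡⟨ cong (λ r → r + χ≤ (triangle (suc r)) (suc (triangle s + s)))
                                                            (troot-triangle+ s s ≤-refl) ⟩
  s + χ≤ (triangle (suc s)) (suc (triangle s + s))  ≡⟨ cong (s +_) (χ≤-yes (≤-reflexive (+-suc (triangle s) s))) ⟩
  s + 1                                             ≡⟨ +-comm s 1 ⟩
  suc s                                             ∎
  where open ≡-Reasoning
troot-triangle+ s (suc y) 1+y≤s = begin
  troot (triangle s + suc y)                        ≡⟨ cong troot (+-suc (triangle s) y) ⟩
  troot (suc (triangle s + y))                      ≡⟨ cong (λ r → r + χ≤ (triangle (suc r)) (suc (triangle s + y)))
                                                            (troot-triangle+ s y (<⇒≤ 1+y≤s)) ⟩
  s + χ≤ (triangle (suc s)) (suc (triangle s + y))  ≡⟨ cong (s +_) (χ≤-no below-next) ⟩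
  s + 0                                             ≡⟨ +-identityʳ s ⟩
  s                                                 ∎
  where
  open ≡-Reasoning
  below-next : suc (triangle s + y) < triangle (suc s)
  below-next = subst (_< triangle (suc s)) (+-suc (triangle s) y) (+-monoʳ-< (triangle s) (s≤s 1+y≤s))

opaque
  pair : ℕ → ℕ → ℕ
  pair x y = triangle (x + y) + y

  unpair₂ : ℕ → ℕ
  unpair₂ z = z ∸ triangle (troot z)

  unpair₁ : ℕ → ℕ
  unpair₁ z = troot z ∸ unpair₂ z

  pair-def : ∀ x y → pair x y ≡ triangle (x + y) + y
  pair-def x y = refl

  unpair₂-def : ∀ z → unpair₂ z ≡ z ∸ triangle (troot z)
  unpair₂-def z = refl

  unpair₁-def : ∀ z → unpair₁ z ≡ troot z ∸ unpair₂ z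
  unpair₁-def z = refl

  troot-pair : ∀ x y → troot (pair x y) ≡ x + y
  troot-pair x y = troot-triangle+ (x + y) y (m≤n+m y x)

  unpair₂-pair : ∀ x y → unpair₂ (pair x y) ≡ y
  unpair₂-pair x y rewrite troot-pair x y = m+n∸m≡n (triangle (x + y)) y

  unpair₁-pair : ∀ x y → unpair₁ (pair x y) ≡ x
  unpair₁-pair x y = begin
    troot (pair x y) ∸ unpair₂ (pair x y) ≡⟨ cong₂ _∸_ (troot-pair x y) (unpair₂-pair x y) ⟩
    x + y ∸ y                             ≡⟨ m+n∸n≡m x y ⟩
    x                                     ∎
    where open ≡-Reasoning

triangleₚ : ∀ {k} → PRFun k → PRFun k
triangleₚ a = primRec₁ triangle (π (# 1) +ₚ sucₚ (π (# 0))) (λ _ → refl) ⟨ a ∷ [] ⟩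

trootₚ : ∀ {k} → PRFun k → PRFun k
trootₚ a = primRec₁ troot (π (# 1) +ₚ χ≤ₚ (triangleₚ (sucₚ (π (# 1)))) (sucₚ (π (# 0)))) (λ _ → refl)
              ⟨ a ∷ [] ⟩

pairₚ : ∀ {k} → PRFun k → PRFun k → PRFun k
pairₚ a b = pairing ⟨ a ∷ b ∷ [] ⟩
  where
  pairing : PRFun 2
  pairing = withFun (triangleₚ (π (# 0) +ₚ π (# 1)) +ₚ π (# 1)) (λ xs → pair (head xs) (lookup xs (# 1)))
    (λ { (x ∷ y ∷ []) → sym (pair-def x y) })

unpair₂ₚ : ∀ {k} → PRFun k → PRFun k
unpair₂ₚ a = unpairing₂ ⟨ a ∷ [] ⟩
  where
  unpairing₂ : PRFun 1
  unpairing₂ = withFun (π (# 0) ∸ₚ triangleₚ (trootₚ (π (# 0)))) (λ xs → unpair₂ (head xs))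
    (λ { (z ∷ []) → sym (unpair₂-def z) })

unpair₁ₚ : ∀ {k} → PRFun k → PRFun k
unpair₁ₚ a = unpairing₁ ⟨ a ∷ [] ⟩
  where
  unpairing₁ : PRFun 1
  unpairing₁ = withFun (trootₚ (π (# 0)) ∸ₚ unpair₂ₚ (π (# 0))) (λ xs → unpair₁ (head xs))
    (λ { (z ∷ []) → sym (unpair₁-def z) })

-- The staged Ackermann computation

Config : Set
Config = List ℕ × ℕ

step : Config → Config
step ([] , n) = [] , n
step (zero ∷ S , n) = S , suc n
step (suc m ∷ S , zero) = m ∷ S , 1
step (suc m ∷ S , suc n) = suc m ∷ m ∷ S , n

ackRun : ℕ → ℕ → ℕ → Config
ackRun m n t = fold (m ∷ [] , n) step t

value : Config → ℕ
value (S , n) = foldl (λ r m → ack m r) n S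

value-step : ∀ c → value (step c) ≡ value c
value-step ([] , n) = refl
value-step (zero ∷ S , n) = refl
value-step (suc m ∷ S , zero) = refl
value-step (suc m ∷ S , suc n) = refl

value-fold : ∀ c t → value (fold c step t) ≡ value c
value-fold c zero = refl
value-fold c (suc t) = trans (value-step (fold c step t)) (value-fold c t)

counter-step : ∀ c → proj₂ (step c) ≤ suc (proj₂ c)
counter-step ([] , n) = n≤1+n n
counter-step (zero ∷ S , n) = ≤-refl
counter-step (suc m ∷ S , zero) = ≤-refl
counter-step (suc m ∷ S , suc n) = m≤n⇒m≤1+n (n≤1+n n)

counter-fold : ∀ c t → proj₂ (fold c step t) ≤ t + proj₂ c
counter-fold c zero = ≤-refl
counter-fold c (suc t) = ≤-trans (counter-step (fold c step t)) (s≤s (counter-fold c t))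

step-computes-ack : ∀ m n S → ∃ λ t → fold (m ∷ S , n) step t ≡ (S , ack m n)
step-computes-ack zero n S = 1 , refl
step-computes-ack (suc m) zero S with step-computes-ack m 1 S
... | t , run = t + 1 , trans (fold-+ _ step t) run
step-computes-ack (suc m) (suc n) S with step-computes-ack (suc m) n (m ∷ S) | step-computes-ack m (ack (suc m) n) S
... | t₁ , run₁ | t₂ , run₂ = t₂ + t₁ + 1 , (begin
  fold c step (t₂ + t₁ + 1)                ≡⟨ fold-+ c step (t₂ + t₁) ⟩
  fold (step c) step (t₂ + t₁)             ≡⟨ fold-+ (step c) step t₂ ⟩
  fold (fold (step c) step t₁) step t₂     ≡⟨ cong (λ c′ → fold c′ step t₂) run₁ ⟩
  fold (m ∷ S , ack (suc m) n) step t₂     ≡⟨ run₂ ⟩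
  (S , ack (suc m) (suc n))                ∎)
  where
  open ≡-Reasoning
  c = (suc m ∷ S , suc n)

drained-config : ∀ {c} → proj₁ c ≡ [] → c ≡ ([] , value c)
drained-config refl = refl

ackRun-drained : ∀ {m n t} → proj₁ (ackRun m n t) ≡ [] → ackRun m n t ≡ ([] , ack m n)
ackRun-drained {m} {n} {t} drained = trans (drained-config drained) (cong (λ v → [] , v) (value-fold (m ∷ [] , n) t))

record State : Set where
  constructor state
  field
    phase : ℕ
    start : ℕ
    config : Config
open State

fresh : ℕ → ℕ → State
fresh j i = state j i (j ∷ [] , i)

next : ℕ → State → State
next i (state k u ([] , n)) = fresh (suc k) (suc i)
next i (state k u (m ∷ S , n)) = state k u (step (m ∷ S , n))

stage : ℕ → State
stage zero = fresh 0 0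
stage (suc i) = next i (stage i)

next-busy : ∀ {i k u c} → proj₁ c ≢ [] → next i (state k u c) ≡ state k u (step c)
next-busy {c = [] , n} S≢[] = contradiction refl S≢[]
next-busy {c = m ∷ S , n} S≢[] = refl

⌜_⌝ˡ : List ℕ → ℕ
⌜ [] ⌝ˡ = 0
⌜ m ∷ S ⌝ˡ = suc (pair m ⌜ S ⌝ˡ)

⌜_⌝ᶜ : Config → ℕ
⌜ S , n ⌝ᶜ = pair ⌜ S ⌝ˡ n

⌜_⌝ˢ : State → ℕ
⌜ state k u c ⌝ˢ = pair k (pair u ⌜ c ⌝ᶜ)

consₚ : ∀ {k} → PRFun k → PRFun k → PRFun k
consₚ a b = sucₚ (pairₚ a b)

stepₚ : PRFun 1
stepₚ = ifZeroₚ m (pairₚ S′ (sucₚ n))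
          (ifZeroₚ n (pairₚ (consₚ (predₚ m) S′) (constₚ 1))
                     (pairₚ (consₚ m (consₚ (predₚ m) S′)) (predₚ n)))
  where
  S = unpair₁ₚ (π (# 0))
  n = unpair₂ₚ (π (# 0))
  m = unpair₁ₚ (predₚ S)
  S′ = unpair₂ₚ (predₚ S)

stepₚ-correct : ∀ m S n → fun stepₚ (⌜ m ∷ S , n ⌝ᶜ ∷ []) ≡ ⌜ step (m ∷ S , n) ⌝ᶜ
stepₚ-correct m S n
  rewrite unpair₁-pair ⌜ m ∷ S ⌝ˡ n | unpair₂-pair ⌜ m ∷ S ⌝ˡ n
        | unpair₁-pair m ⌜ S ⌝ˡ | unpair₂-pair m ⌜ S ⌝ˡ
  with m | n
... | zero | _ = refl
... | suc m | zero = refl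
... | suc m | suc n = refl

phaseₚ : ∀ {k} → PRFun k → PRFun k
phaseₚ z = unpair₁ₚ z

startₚ : ∀ {k} → PRFun k → PRFun k
startₚ z = unpair₁ₚ (unpair₂ₚ z)

configₚ : ∀ {k} → PRFun k → PRFun k
configₚ z = unpair₂ₚ (unpair₂ₚ z)

unpair₁-⌜⌝ˢ : ∀ s → unpair₁ ⌜ s ⌝ˢ ≡ phase s
unpair₁-⌜⌝ˢ (state k u c) = unpair₁-pair k _

decode-⌜⌝ˢ : ∀ s → _≡_ {A = Vec ℕ 3}
  (unpair₁ ⌜ s ⌝ˢ ∷ unpair₁ (unpair₂ ⌜ s ⌝ˢ) ∷ unpair₂ (unpair₂ ⌜ s ⌝ˢ) ∷ [])
  (phase s ∷ start s ∷ ⌜ config s ⌝ᶜ ∷ [])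
decode-⌜⌝ˢ (state k u c) rewrite unpair₁-pair k (pair u ⌜ c ⌝ᶜ) | unpair₂-pair k (pair u ⌜ c ⌝ᶜ)
  | unpair₁-pair u ⌜ c ⌝ᶜ | unpair₂-pair u ⌜ c ⌝ᶜ = refl

freshₚ : ∀ {k} → PRFun k → PRFun k → PRFun k
freshₚ j i = pairₚ j (pairₚ i (pairₚ (consₚ j (constₚ 0)) i))

nextFromFieldsₚ : PRFun 4
nextFromFieldsₚ = ifZeroₚ (unpair₁ₚ c) (freshₚ (sucₚ k) (sucₚ i))
                                       (pairₚ k (pairₚ u (stepₚ ⟨ c ∷ [] ⟩)))
  where
  i = π (# 0)
  k = π (# 1)
  u = π (# 2)
  c = π (# 3)

nextFromFieldsₚ-correct : ∀ i k u c →
  fun nextFromFieldsₚ (i ∷ k ∷ u ∷ ⌜ c ⌝ᶜ ∷ []) ≡ ⌜ next i (state k u c) ⌝ˢ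
nextFromFieldsₚ-correct i k u ([] , n) rewrite unpair₁-pair 0 n = refl
nextFromFieldsₚ-correct i k u (m ∷ S , n) =
  trans (ifZero-suc (unpair₁-pair ⌜ m ∷ S ⌝ˡ n)) (cong (λ c → pair k (pair u c)) (stepₚ-correct m S n))

nextₚ : PRFun 2
nextₚ = nextFromFieldsₚ ⟨ π (# 0) ∷ phaseₚ (π (# 1)) ∷ startₚ (π (# 1)) ∷ configₚ (π (# 1)) ∷ [] ⟩

nextₚ-correct : ∀ i s → fun nextₚ (i ∷ ⌜ s ⌝ˢ ∷ []) ≡ ⌜ next i s ⌝ˢ
nextₚ-correct i s@(state k u c) =
  trans (cong (λ (fields : Vec ℕ 3) → fun nextFromFieldsₚ (i ∷ fields)) (decode-⌜⌝ˢ s))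
        (nextFromFieldsₚ-correct i k u c)

stageₚ : ∀ {k} → PRFun k → PRFun k
stageₚ a = primRec₁ (λ i → ⌜ stage i ⌝ˢ) nextₚ (λ i → nextₚ-correct i (stage i)) ⟨ a ∷ [] ⟩

-- Phases

least : ∀ {P : ℕ → Set} → Decidable P → ∀ {n} → P n → ∃ λ m → P m × (∀ {k} → k < m → ¬ P k)
least P? {zero} p = 0 , p , λ ()
least P? {suc n} p with P? 0
... | yes p₀ = 0 , p₀ , λ ()
... | no ¬p₀ with least (λ k → P? (suc k)) p
...   | m , pm , below-m = suc m , pm , λ { {zero} _ → ¬p₀ ; {suc k} k<m → below-m (s≤s⁻¹ k<m) }

record Phase (j a : ℕ) : Set where
  field
    length : ℕ
    stage-in-phase : ∀ {t} → t ≤ length → stage (a + t) ≡ state j a (ackRun j a t)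
    busy : ∀ {t} → t < length → proj₁ (ackRun j a t) ≢ []
    drained : ackRun j a length ≡ ([] , ack j a)

  end : ℕ
  end = a + length

  stage-end : stage end ≡ state j a ([] , ack j a)
  stage-end = trans (stage-in-phase ≤-refl) (cong (state j a) drained)

  stage-after-end : stage (suc end) ≡ fresh (suc j) (suc end)
  stage-after-end = cong (next end) stage-end

  ack≤end : ack j a ≤ end
  ack≤end = begin
    ack j a                    ≡⟨ cong proj₂ drained ⟨
    proj₂ (ackRun j a length)  ≤⟨ counter-fold (j ∷ [] , a) length ⟩
    length + a                 ≡⟨ +-comm length a ⟩
    end                        ∎
    where open ≤-Reasoning

phase-from-fresh : ∀ j a → stage a ≡ fresh j a → Phase j a
phase-from-fresh j a stage-a with step-computes-ack j a []
... | T , run-T with least (λ t → ≡-dec _≟_ (proj₁ (ackRun j a t)) []) {T} (cong proj₁ run-T)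
...   | len , drained , busy = record
  { length = len ; stage-in-phase = simulate ; busy = busy ; drained = ackRun-drained {j} {a} {len} drained }
  where
  simulate : ∀ {t} → t ≤ len → stage (a + t) ≡ state j a (ackRun j a t)
  simulate {zero} _ = trans (cong stage (+-identityʳ a)) stage-a
  simulate {suc t} t<len = begin
    stage (a + suc t)                       ≡⟨ cong stage (+-suc a t) ⟩
    next (a + t) (stage (a + t))            ≡⟨ cong (next (a + t)) (simulate (<⇒≤ t<len)) ⟩
    next (a + t) (state j a (ackRun j a t)) ≡⟨ next-busy (busy t<len) ⟩
    state j a (ackRun j a (suc t))          ∎
    where open ≡-Reasoning

phases : ∀ j → Σ ℕ (Phase j)
phases zero = 0 , phase-from-fresh 0 0 refl
phases (suc j) = suc (Phase.end P) , phase-from-fresh (suc j) _ (Phase.stage-after-end P)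
  where P = proj₂ (phases j)

phaseStart : ℕ → ℕ
phaseStart j = proj₁ (phases j)

phaseEnd : ℕ → ℕ
phaseEnd j = Phase.end (proj₂ (phases j))

record InPhase (i j : ℕ) : Set where
  constructor inPhase
  field
    start≤i : phaseStart j ≤ i
    i≤end : i ≤ phaseEnd j

phaseStart≤phaseEnd : ∀ j → phaseStart j ≤ phaseEnd j
phaseStart≤phaseEnd j = m≤m+n (phaseStart j) _

inPhase-start : ∀ j → InPhase (phaseStart j) j
inPhase-start j = inPhase ≤-refl (phaseStart≤phaseEnd j)

inPhase-end : ∀ j → InPhase (phaseEnd j) j
inPhase-end j = inPhase (phaseStart≤phaseEnd j) ≤-refl

inPhase-suc : ∀ {i j} → InPhase i j → i < phaseEnd j → InPhase (suc i) j
inPhase-suc (inPhase start≤i _) i<end = inPhase (m≤n⇒m≤1+n start≤i) i<end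

stage-inPhase : ∀ {i j} → InPhase i j →
  stage i ≡ state j (phaseStart j) (ackRun j (phaseStart j) (i ∸ phaseStart j))
stage-inPhase {i} {j} (inPhase start≤i i≤end) =
  trans (cong stage (sym (m+[n∸m]≡n start≤i))) (Phase.stage-in-phase (proj₂ (phases j)) offset≤length)
  where
  offset≤length : i ∸ phaseStart j ≤ Phase.length (proj₂ (phases j))
  offset≤length = subst (i ∸ phaseStart j ≤_) (m+n∸m≡n (phaseStart j) _) (∸-monoˡ-≤ (phaseStart j) i≤end)

phase-inPhase : ∀ {i j} → InPhase i j → phase (stage i) ≡ j
phase-inPhase i∈j = cong phase (stage-inPhase i∈j)

busy-inPhase : ∀ {i j} → InPhase i j → i < phaseEnd j → proj₁ (config (stage i)) ≢ []
busy-inPhase {i} {j} i∈j@(inPhase start≤i _) i<end rewrite stage-inPhase i∈j =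
  Phase.busy (proj₂ (phases j))
    (+-cancelˡ-< (phaseStart j) _ _ (subst (_< phaseEnd j) (sym (m+[n∸m]≡n start≤i)) i<end))

stage-phaseEnd : ∀ j → stage (phaseEnd j) ≡ state j (phaseStart j) ([] , ack j (phaseStart j))
stage-phaseEnd j = Phase.stage-end (proj₂ (phases j))

ack≤phaseEnd : ∀ j → ack j (phaseStart j) ≤ phaseEnd j
ack≤phaseEnd j = Phase.ack≤end (proj₂ (phases j))

phaseStart-<-suc : ∀ j → phaseStart j < phaseStart (suc j)
phaseStart-<-suc j = s≤s (phaseStart≤phaseEnd j)

phaseStart-mono-≤ : ∀ {j j′} → j ≤ j′ → phaseStart j ≤ phaseStart j′
phaseStart-mono-≤ = mono-≤-from-step phaseStart (λ j → <⇒≤ (phaseStart-<-suc j))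

phaseStart-cancel-< : ∀ {j j′} → phaseStart j < phaseStart j′ → j < j′
phaseStart-cancel-< start<start′ = ≰⇒> (λ j′≤j → <⇒≱ start<start′ (phaseStart-mono-≤ j′≤j))

j≤phaseStart : ∀ j → j ≤ phaseStart j
j≤phaseStart zero = z≤n
j≤phaseStart (suc j) = ≤-trans (s≤s (j≤phaseStart j)) (phaseStart-<-suc j)

locate : ∀ i → ∃ (InPhase i)
locate zero = 0 , inPhase-start 0
locate (suc i) with locate i
... | j , i∈j with m≤n⇒m<n∨m≡n (InPhase.i≤end i∈j)
...   | inj₁ i<end = j , inPhase-suc i∈j i<end
...   | inj₂ refl = suc j , inPhase-start (suc j)

-- The copy

lsb : ℕ → ℕ
lsb zero = 0
lsb (suc zero) = 1
lsb (suc (suc n)) = lsb n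

lsb-suc : ∀ n → lsb (suc n) ≡ ifZero (lsb n) 1 0
lsb-suc zero = refl
lsb-suc (suc zero) = refl
lsb-suc (suc (suc n)) = lsb-suc n

lsb-01 : ∀ n → lsb n ≡ 0 ⊎ lsb n ≡ 1
lsb-01 zero = inj₁ refl
lsb-01 (suc zero) = inj₂ refl
lsb-01 (suc (suc n)) = lsb-01 n

lsb-dichotomy : ∀ x j → lsb x ≡ lsb j ⊎ lsb x ≡ lsb (suc j)
lsb-dichotomy x j rewrite lsb-suc j with lsb-01 x | lsb-01 j
... | inj₁ x₀ | inj₁ j₀ = inj₁ (trans x₀ (sym j₀))
... | inj₁ x₀ | inj₂ j₁ rewrite j₁ = inj₂ x₀
... | inj₂ x₁ | inj₁ j₀ rewrite j₀ = inj₂ x₁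
... | inj₂ x₁ | inj₂ j₁ = inj₁ (trans x₁ (sym j₁))

lsb[lsb[j]+j]≡0 : ∀ j → lsb (lsb j + j) ≡ 0
lsb[lsb[j]+j]≡0 zero = refl
lsb[lsb[j]+j]≡0 (suc zero) = refl
lsb[lsb[j]+j]≡0 (suc (suc j)) rewrite +-suc (lsb j) (suc j) | +-suc (lsb j) j = lsb[lsb[j]+j]≡0 j

lsb[lsb[1+j]+j]≡1 : ∀ j → lsb (lsb (suc j) + j) ≡ 1
lsb[lsb[1+j]+j]≡1 zero = refl
lsb[lsb[1+j]+j]≡1 (suc zero) = refl
lsb[lsb[1+j]+j]≡1 (suc (suc j)) rewrite +-suc (lsb (suc j)) (suc j) | +-suc (lsb (suc j)) j = lsb[lsb[1+j]+j]≡1 j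

⌊n+1/2⌋≡⌊n/2⌋+lsb : ∀ n → ⌊ suc n /2⌋ ≡ ⌊ n /2⌋ + lsb n
⌊n+1/2⌋≡⌊n/2⌋+lsb zero = refl
⌊n+1/2⌋≡⌊n/2⌋+lsb (suc zero) = refl
⌊n+1/2⌋≡⌊n/2⌋+lsb (suc (suc n)) = cong suc (⌊n+1/2⌋≡⌊n/2⌋+lsb n)

cell : ℕ → ℕ → ℕ
cell zero b = b
cell (suc i) b = suc (suc (cell i b))

lsb-cell : ∀ i b → lsb (cell i b) ≡ lsb b
lsb-cell zero b = refl
lsb-cell (suc i) b = lsb-cell i b

⌊cell/2⌋ : ∀ i n → ⌊ cell i (lsb n) /2⌋ ≡ i
⌊cell/2⌋ zero n with lsb-01 n
... | inj₁ n₀ rewrite n₀ = refl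
... | inj₂ n₁ rewrite n₁ = refl
⌊cell/2⌋ (suc i) n = cong suc (⌊cell/2⌋ i n)

lsb-lsb : ∀ n → lsb (lsb n) ≡ lsb n
lsb-lsb n with lsb-01 n
... | inj₁ n₀ rewrite n₀ = refl
... | inj₂ n₁ rewrite n₁ = refl

cell-⌊/2⌋-lsb : ∀ x → cell ⌊ x /2⌋ (lsb x) ≡ x
cell-⌊/2⌋-lsb zero = refl
cell-⌊/2⌋-lsb (suc zero) = refl
cell-⌊/2⌋-lsb (suc (suc x)) = cong (λ y → suc (suc y)) (cell-⌊/2⌋-lsb x)

cell-of : ∀ {x b} → lsb x ≡ b → x ≡ cell ⌊ x /2⌋ b
cell-of {x} refl = sym (cell-⌊/2⌋-lsb x)

lsbₚ : ∀ {k} → PRFun k → PRFun k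
lsbₚ a = primRec₁ lsb (ifZeroₚ (π (# 1)) (constₚ 1) (constₚ 0)) (λ n → sym (lsb-suc n)) ⟨ a ∷ [] ⟩

halfₚ : ∀ {k} → PRFun k → PRFun k
halfₚ a = primRec₁ ⌊_/2⌋ (π (# 1) +ₚ lsbₚ (π (# 0))) (λ n → sym (⌊n+1/2⌋≡⌊n/2⌋+lsb n))
             ⟨ a ∷ [] ⟩

cellₚ : ∀ {k} → PRFun k → PRFun k → PRFun k
cellₚ i b = primRec (λ n ys → cell n (head ys)) (π (# 0)) (sucₚ (sucₚ (π (# 1))))
  (λ { (b ∷ []) → refl }) (λ { n (b ∷ []) → refl }) ⟨ i ∷ b ∷ [] ⟩

cell-cases : ∀ (P : ℕ → Set) → (∀ {i j} → InPhase i j → P (cell i (lsb j))) →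
  (∀ {i j} → InPhase i j → P (cell i (lsb (suc j)))) → ∀ x → P x
cell-cases P on-same on-next x with locate ⌊ x /2⌋
... | j , x∈j with lsb-dichotomy x j
...   | inj₁ same = subst P (sym (cell-of same)) (on-same x∈j)
...   | inj₂ next = subst P (sym (cell-of next)) (on-next x∈j)

-- For b ∈ {0, 1}, lsb (b + k) is 0 exactly when b is the track lsb k of block k.
blockAt : ℕ → ℕ → ℕ
blockAt b k = k + lsb (b + k)

block : ℕ → ℕ
block x = blockAt (lsb x) (phase (stage ⌊ x /2⌋))

pos : ℕ → ℕ
pos x = ⌊ x /2⌋ + phaseStart (block x)

block-cell : ∀ i b → block (cell i (lsb b)) ≡ blockAt (lsb b) (phase (stage i))
block-cell i b rewrite ⌊cell/2⌋ i b | lsb-cell i (lsb b) | lsb-lsb b = refl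

block-cell-same : ∀ {i j} → InPhase i j → block (cell i (lsb j)) ≡ j
block-cell-same {i} {j} i∈j = begin
  block (cell i (lsb j))             ≡⟨ block-cell i j ⟩
  blockAt (lsb j) (phase (stage i))  ≡⟨ cong (blockAt (lsb j)) (phase-inPhase i∈j) ⟩
  j + lsb (lsb j + j)                ≡⟨ cong (j +_) (lsb[lsb[j]+j]≡0 j) ⟩
  j + 0                              ≡⟨ +-identityʳ j ⟩
  j                                  ∎
  where open ≡-Reasoning

block-cell-next : ∀ {i j} → InPhase i j → block (cell i (lsb (suc j))) ≡ suc j
block-cell-next {i} {j} i∈j = begin
  block (cell i (lsb (suc j)))            ≡⟨ block-cell i (suc j) ⟩
  blockAt (lsb (suc j)) (phase (stage i)) ≡⟨ cong (blockAt (lsb (suc j))) (phase-inPhase i∈j) ⟩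
  j + lsb (lsb (suc j) + j)               ≡⟨ cong (j +_) (lsb[lsb[1+j]+j]≡1 j) ⟩
  j + 1                                   ≡⟨ +-comm j 1 ⟩
  suc j                                   ∎
  where open ≡-Reasoning

pos-cell-same : ∀ {i j} → InPhase i j → pos (cell i (lsb j)) ≡ i + phaseStart j
pos-cell-same {i} {j} i∈j = cong₂ (λ h b → h + phaseStart b) (⌊cell/2⌋ i j) (block-cell-same i∈j)

pos-cell-next : ∀ {i j} → InPhase i j → pos (cell i (lsb (suc j))) ≡ i + phaseStart (suc j)
pos-cell-next {i} {j} i∈j = cong₂ (λ h b → h + phaseStart b) (⌊cell/2⌋ i (suc j)) (block-cell-next i∈j)

jump : ℕ → ℕ → State → ℕ
jump b i (state k u ([] , _)) = ifZero (lsb (b + k)) (cell u (lsb (suc k))) (cell (suc i) b)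
jump b i (state k u (_ ∷ _ , _)) = cell (suc i) b

succA : ℕ → ℕ
succA x = jump (lsb x) ⌊ x /2⌋ (stage ⌊ x /2⌋)

succA-cell : ∀ i b → succA (cell i (lsb b)) ≡ jump (lsb b) i (stage i)
succA-cell i b rewrite ⌊cell/2⌋ i b | lsb-cell i (lsb b) | lsb-lsb b = refl

succA-busy : ∀ {i j} b → InPhase i j → i < phaseEnd j → succA (cell i (lsb b)) ≡ cell (suc i) (lsb b)
succA-busy {i} b i∈j i<end = trans (succA-cell i b) (jump-busy (stage i) (busy-inPhase i∈j i<end))
  where
  jump-busy : ∀ s → proj₁ (config s) ≢ [] → jump (lsb b) i s ≡ cell (suc i) (lsb b)
  jump-busy (state k u ([] , n)) S≢[] = contradiction refl S≢[]
  jump-busy (state k u (_ ∷ _ , n)) S≢[] = refl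

succA-end-same : ∀ j → succA (cell (phaseEnd j) (lsb j)) ≡ cell (phaseStart j) (lsb (suc j))
succA-end-same j rewrite succA-cell (phaseEnd j) j | stage-phaseEnd j | lsb[lsb[j]+j]≡0 j = refl

succA-end-next : ∀ j → succA (cell (phaseEnd j) (lsb (suc j))) ≡ cell (phaseStart (suc j)) (lsb (suc j))
succA-end-next j rewrite succA-cell (phaseEnd j) (suc j) | stage-phaseEnd j | lsb[lsb[1+j]+j]≡1 j = refl

pos-succA-same : ∀ {i j} → InPhase i j → pos (succA (cell i (lsb j))) ≡ suc (pos (cell i (lsb j)))
pos-succA-same {i} {j} i∈j with m≤n⇒m<n∨m≡n (InPhase.i≤end i∈j)
... | inj₁ i<end = begin
  pos (succA (cell i (lsb j)))  ≡⟨ cong pos (succA-busy j i∈j i<end) ⟩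
  pos (cell (suc i) (lsb j))    ≡⟨ pos-cell-same (inPhase-suc i∈j i<end) ⟩
  suc (i + phaseStart j)        ≡⟨ cong suc (sym (pos-cell-same i∈j)) ⟩
  suc (pos (cell i (lsb j)))    ∎
  where open ≡-Reasoning
... | inj₂ refl = begin
  pos (succA (cell (phaseEnd j) (lsb j)))  ≡⟨ cong pos (succA-end-same j) ⟩
  pos (cell (phaseStart j) (lsb (suc j)))  ≡⟨ pos-cell-next (inPhase-start j) ⟩
  phaseStart j + suc (phaseEnd j)          ≡⟨ +-suc (phaseStart j) (phaseEnd j) ⟩
  suc (phaseStart j + phaseEnd j)          ≡⟨ cong suc (+-comm (phaseStart j) (phaseEnd j)) ⟩
  suc (phaseEnd j + phaseStart j)          ≡⟨ cong suc (sym (pos-cell-same (inPhase-end j))) ⟩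
  suc (pos (cell (phaseEnd j) (lsb j)))    ∎
  where open ≡-Reasoning

pos-succA-next : ∀ {i j} → InPhase i j → pos (succA (cell i (lsb (suc j)))) ≡ suc (pos (cell i (lsb (suc j))))
pos-succA-next {i} {j} i∈j with m≤n⇒m<n∨m≡n (InPhase.i≤end i∈j)
... | inj₁ i<end = begin
  pos (succA (cell i (lsb (suc j))))  ≡⟨ cong pos (succA-busy (suc j) i∈j i<end) ⟩
  pos (cell (suc i) (lsb (suc j)))    ≡⟨ pos-cell-next (inPhase-suc i∈j i<end) ⟩
  suc (i + phaseStart (suc j))        ≡⟨ cong suc (sym (pos-cell-next i∈j)) ⟩
  suc (pos (cell i (lsb (suc j))))    ∎
  where open ≡-Reasoning
... | inj₂ refl = begin
  pos (succA (cell (phaseEnd j) (lsb (suc j))))     ≡⟨ cong pos (succA-end-next j) ⟩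
  pos (cell (phaseStart (suc j)) (lsb (suc j)))     ≡⟨ pos-cell-same (inPhase-start (suc j)) ⟩
  suc (phaseEnd j + phaseStart (suc j))             ≡⟨ cong suc (sym (pos-cell-next (inPhase-end j))) ⟩
  suc (pos (cell (phaseEnd j) (lsb (suc j))))       ∎
  where open ≡-Reasoning

pos-succA : ∀ x → pos (succA x) ≡ suc (pos x)
pos-succA = cell-cases (λ x → pos (succA x) ≡ suc (pos x)) pos-succA-same pos-succA-next

lsb-block : ∀ x → lsb x ≡ lsb (block x)
lsb-block = cell-cases (λ x → lsb x ≡ lsb (block x))
  (λ {i} {j} i∈j → trans (trans (lsb-cell i (lsb j)) (lsb-lsb j)) (cong lsb (sym (block-cell-same i∈j))))
  (λ {i} {j} i∈j → trans (trans (lsb-cell i (lsb (suc j))) (lsb-lsb (suc j))) (cong lsb (sym (block-cell-next i∈j))))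

pos-bounds : ∀ x → phaseStart (block x) + phaseStart (pred (block x)) ≤ pos x
                 × pos x < phaseStart (block x) + phaseStart (suc (block x))
pos-bounds = cell-cases Bounds on-same on-next
  where
  Bounds : ℕ → Set
  Bounds x = phaseStart (block x) + phaseStart (pred (block x)) ≤ pos x
           × pos x < phaseStart (block x) + phaseStart (suc (block x))
  on-same : ∀ {i j} → InPhase i j → Bounds (cell i (lsb j))
  on-same {i} {j} i∈j@(inPhase start≤i i≤end) rewrite pos-cell-same i∈j | block-cell-same i∈j =
    subst (_≤ i + phaseStart j) (+-comm (phaseStart (pred j)) (phaseStart j))
          (+-monoˡ-≤ (phaseStart j) (≤-trans (phaseStart-mono-≤ {pred j} {j} pred[n]≤n) start≤i)) ,
    subst (i + phaseStart j <_) (+-comm (phaseStart (suc j)) (phaseStart j)) (+-monoˡ-< (phaseStart j) (s≤s i≤end))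
  on-next : ∀ {i j} → InPhase i j → Bounds (cell i (lsb (suc j)))
  on-next {i} {j} i∈j@(inPhase start≤i i≤end) rewrite pos-cell-next i∈j | block-cell-next i∈j =
    subst (_≤ i + phaseStart (suc j)) (+-comm (phaseStart j) (phaseStart (suc j)))
          (+-monoˡ-≤ (phaseStart (suc j)) start≤i) ,
    subst (i + phaseStart (suc j) <_) (+-comm (phaseStart (suc (suc j))) (phaseStart (suc j)))
          (+-monoˡ-< (phaseStart (suc j)) (<-trans (s≤s i≤end) (phaseStart-<-suc (suc j))))

pos-<-block : ∀ x y → block x < block y → pos x < pos y
pos-<-block x y bx<by = begin-strict
  pos x                                              <⟨ proj₂ (pos-bounds x) ⟩
  phaseStart (block x) + phaseStart (suc (block x))  ≡⟨ +-comm (phaseStart (block x)) _ ⟩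
  phaseStart (suc (block x)) + phaseStart (block x)  ≤⟨ +-mono-≤ (phaseStart-mono-≤ bx<by)
                                                                 (phaseStart-mono-≤ (<⇒≤pred bx<by)) ⟩
  phaseStart (block y) + phaseStart (pred (block y))    ≤⟨ proj₁ (pos-bounds y) ⟩
  pos y                                              ∎
  where open ≤-Reasoning

pos-injective : ∀ x y → pos x ≡ pos y → x ≡ y
pos-injective x y px≡py with <-cmp (block x) (block y)
... | tri< bx<by _ _ = contradiction px≡py (<⇒≢ (pos-<-block x y bx<by))
... | tri> _ _ by<bx = contradiction (sym px≡py) (<⇒≢ (pos-<-block y x by<bx))
... | tri≈ _ bx≡by _ = begin
  x                       ≡⟨ cell-of refl ⟩
  cell ⌊ x /2⌋ (lsb x)    ≡⟨ cong₂ cell ⌊x/2⌋≡⌊y/2⌋ lsbx≡lsby ⟩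
  cell ⌊ y /2⌋ (lsb y)    ≡⟨ cell-⌊/2⌋-lsb y ⟩
  y                       ∎
  where
  open ≡-Reasoning
  ⌊x/2⌋≡⌊y/2⌋ : ⌊ x /2⌋ ≡ ⌊ y /2⌋
  ⌊x/2⌋≡⌊y/2⌋ = +-cancelʳ-≡ (phaseStart (block x)) _ _
                  (trans px≡py (cong (λ b → ⌊ y /2⌋ + phaseStart b) (sym bx≡by)))
  lsbx≡lsby : lsb x ≡ lsb y
  lsbx≡lsby = trans (lsb-block x) (trans (cong lsb bx≡by) (sym (lsb-block y)))

toCopy : ℕ → ℕ
toCopy n = fold 0 succA n

pos-toCopy : ∀ n → pos (toCopy n) ≡ n
pos-toCopy zero = refl
pos-toCopy (suc n) = trans (pos-succA (toCopy n)) (cong suc (pos-toCopy n))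

copy : ℕ ↔ ℕ
copy = mk↔ₛ′ toCopy pos (λ x → pos-injective (toCopy (pos x)) x (pos-toCopy (pos x))) pos-toCopy

_≤ₗₑₓ_ : ℕ × ℕ → ℕ × ℕ → Set
_≤ₗₑₓ_ = ×-Lex _≡_ _<_ _≤_

pos≤⇔≤ₗₑₓ : ∀ x y → (pos x ≤ pos y) ⇔ ((block x , ⌊ x /2⌋) ≤ₗₑₓ (block y , ⌊ y /2⌋))
pos≤⇔≤ₗₑₓ x y = mk⇔ to from
  where
  to : pos x ≤ pos y → (block x , ⌊ x /2⌋) ≤ₗₑₓ (block y , ⌊ y /2⌋)
  to px≤py with <-cmp (block x) (block y)
  ... | tri< bx<by _ _ = inj₁ bx<by
  ... | tri> _ _ by<bx = contradiction px≤py (<⇒≱ (pos-<-block y x by<bx))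
  ... | tri≈ _ bx≡by _ = inj₂ (bx≡by , +-cancelʳ-≤ (phaseStart (block x)) _ _
                                         (subst (λ b → pos x ≤ ⌊ y /2⌋ + phaseStart b) (sym bx≡by) px≤py))
  from : (block x , ⌊ x /2⌋) ≤ₗₑₓ (block y , ⌊ y /2⌋) → pos x ≤ pos y
  from (inj₁ bx<by) = <⇒≤ (pos-<-block x y bx<by)
  from (inj₂ (bx≡by , hx≤hy)) = subst (λ b → pos x ≤ ⌊ y /2⌋ + phaseStart b) bx≡by (+-monoˡ-≤ _ hx≤hy)

jumpFromFieldsₚ : PRFun 5
jumpFromFieldsₚ = ifZeroₚ (unpair₁ₚ c) (ifZeroₚ (lsbₚ (b +ₚ k)) (cellₚ u (lsbₚ (sucₚ k))) (cellₚ (sucₚ i) b))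
                                       (cellₚ (sucₚ i) b)
  where
  b = π (# 0)
  i = π (# 1)
  k = π (# 2)
  u = π (# 3)
  c = π (# 4)

jumpFromFieldsₚ-correct : ∀ b i k u c →
  fun jumpFromFieldsₚ (b ∷ i ∷ k ∷ u ∷ ⌜ c ⌝ᶜ ∷ []) ≡ jump b i (state k u c)
jumpFromFieldsₚ-correct b i k u ([] , n) rewrite unpair₁-pair 0 n = refl
jumpFromFieldsₚ-correct b i k u (m ∷ S , n) = ifZero-suc (unpair₁-pair ⌜ m ∷ S ⌝ˡ n)

succAₚ : PRFun 1
succAₚ = jumpFromFieldsₚ ⟨ lsbₚ x ∷ halfₚ x ∷ phaseₚ z ∷ startₚ z ∷ configₚ z ∷ [] ⟩
  where
  x = π (# 0)
  z = stageₚ (halfₚ x)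

succAₚ-correct : ∀ x → fun succAₚ (x ∷ []) ≡ succA x
succAₚ-correct x =
  trans (cong (λ (fields : Vec ℕ 3) → fun jumpFromFieldsₚ (lsb x ∷ ⌊ x /2⌋ ∷ fields)) (decode-⌜⌝ˢ s))
        (jumpFromFieldsₚ-correct (lsb x) ⌊ x /2⌋ (phase s) (start s) (config s))
  where s = stage ⌊ x /2⌋

blockₚ : ∀ {k} → PRFun k → PRFun k
blockₚ a = withFun (k +ₚ lsbₚ (lsbₚ (π (# 0)) +ₚ k)) (λ xs → block (head xs))
  (λ { (x ∷ []) → cong (blockAt (lsb x)) (unpair₁-⌜⌝ˢ (stage ⌊ x /2⌋)) }) ⟨ a ∷ [] ⟩
  where k = phaseₚ (stageₚ (halfₚ (π (# 0))))

Characterises : Set → ℕ → Set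
Characterises P n = (P × n ≡ 1) ⊎ (¬ P × n ≡ 0)

characterises-⇔ : ∀ {P Q n} → P ⇔ Q → Characterises Q n → Characterises P n
characterises-⇔ P⇔Q (inj₁ (q , n≡1)) = inj₁ (Equivalence.from P⇔Q q , n≡1)
characterises-⇔ P⇔Q (inj₂ (¬q , n≡0)) = inj₂ ((λ p → ¬q (Equivalence.to P⇔Q p)) , n≡0)

lex≤ : ℕ → ℕ → ℕ → ℕ → ℕ
lex≤ a b c d = ifZero (χ≤ (suc a) c) (ifZero (χ≤ a c) 0 (χ≤ b d)) 1

lex≤ₚ : ∀ {k} → PRFun k → PRFun k → PRFun k → PRFun k → PRFun k
lex≤ₚ a b c d = ifZeroₚ (χ≤ₚ (sucₚ a) c) (ifZeroₚ (χ≤ₚ a c) (constₚ 0) (χ≤ₚ b d)) (constₚ 1)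

lex≤-characterises : ∀ a b c d → Characterises ((a , b) ≤ₗₑₓ (c , d)) (lex≤ a b c d)
lex≤-characterises a b c d with <-cmp a c
... | tri< a<c _ _ rewrite χ≤-yes a<c = inj₁ (inj₁ a<c , refl)
... | tri> _ _ c<a rewrite χ≤-no (m<n⇒m<1+n c<a) | χ≤-no c<a = inj₂ (not-lex , refl)
  where
  not-lex : ¬ (a , b) ≤ₗₑₓ (c , d)
  not-lex (inj₁ a<c) = <-asym a<c c<a
  not-lex (inj₂ (a≡c , _)) = <-irrefl (sym a≡c) c<a
... | tri≈ _ refl _ rewrite χ≤-no (n<1+n a) | χ≤-yes (≤-refl {a}) with b ≤? d
...   | yes b≤d rewrite χ≤-yes b≤d = inj₁ (inj₂ (refl , b≤d) , refl)
...   | no b≰d rewrite χ≤-no (≰⇒> b≰d) = inj₂ (not-lex , refl)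
  where
  not-lex : ¬ (a , b) ≤ₗₑₓ (a , d)
  not-lex (inj₁ a<a) = <-irrefl refl a<a
  not-lex (inj₂ (_ , b≤d)) = b≰d b≤d

≤-isPR-on-copy : IsPRRel₂ (imageRel copy _≤_)
≤-isPR-on-copy = code χ , λ x y → subst (Characterises (pos x ≤ pos y)) (sym (eval-code χ (x ∷ y ∷ [])))
  (characterises-⇔ (pos≤⇔≤ₗₑₓ x y) (lex≤-characterises (block x) ⌊ x /2⌋ (block y) ⌊ y /2⌋))
  where
  χ : PRFun 2
  χ = lex≤ₚ (blockₚ (π (# 0))) (halfₚ (π (# 0))) (blockₚ (π (# 1))) (halfₚ (π (# 1)))

-- Functions above 2x

inPhase-<-phaseStart : ∀ {i j} k → InPhase i j → i < phaseStart k → j < k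
inPhase-<-phaseStart {j = j} k i∈j i<start = phaseStart-cancel-< {j} {k} (≤-<-trans (InPhase.start≤i i∈j) i<start)

pos<double-start : ∀ k y → ⌊ y /2⌋ < phaseStart k → pos y < phaseStart k + phaseStart k
pos<double-start k = cell-cases Below on-same on-next
  where
  Below : ℕ → Set
  Below y = ⌊ y /2⌋ < phaseStart k → pos y < phaseStart k + phaseStart k
  on-same : ∀ {i j} → InPhase i j → Below (cell i (lsb j))
  on-same {i} {j} i∈j rewrite pos-cell-same i∈j | ⌊cell/2⌋ i j = λ i<start →
    +-mono-<-≤ i<start (phaseStart-mono-≤ {j} {k} (<⇒≤ (inPhase-<-phaseStart k i∈j i<start)))
  on-next : ∀ {i j} → InPhase i j → Below (cell i (lsb (suc j)))
  on-next {i} {j} i∈j rewrite pos-cell-next i∈j | ⌊cell/2⌋ i (suc j) = λ i<start →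
    +-mono-<-≤ i<start (phaseStart-mono-≤ {suc j} {k} (inPhase-<-phaseStart k i∈j i<start))

i≤cell : ∀ i b → i ≤ cell i b
i≤cell zero b = z≤n
i≤cell (suc i) b = s≤s (m≤n⇒m≤1+n (i≤cell i b))

lsb[1+cell[i,0]] : ∀ i → lsb (suc (cell i 0)) ≡ 1
lsb[1+cell[i,0]] zero = refl
lsb[1+cell[i,0]] (suc i) = lsb[1+cell[i,0]] i

image-not-below-ack : ∀ f → EventuallyAboveDouble f → ∀ M → ¬ (∀ s → imageFun copy f (cell s 1) < ack M s)
image-not-below-ack f (N , f>2x) M below = <-asym y<ack ack<y
  where
  -- k is even, so a is the odd number cell (phaseStart k) 1.
  k = cell (M + N) 0
  a = cell (phaseStart k) (lsb (suc k))
  n = pos a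
  y = imageFun copy f a
  M+N≤k : M + N ≤ k
  M+N≤k = i≤cell (M + N) 0
  n≡ : n ≡ phaseStart k + phaseStart (suc k)
  n≡ = pos-cell-next (inPhase-start k)
  N≤n : N ≤ n
  N≤n = ≤-trans (≤-trans (m≤n+m N M) (≤-trans M+N≤k (j≤phaseStart k)))
                (subst (phaseStart k ≤_) (sym n≡) (m≤m+n _ _))
  start≤n : phaseStart (suc k) ≤ n
  start≤n = subst (phaseStart (suc k) ≤_) (sym n≡) (m≤n+m _ _)
  double-start≤2n : phaseStart (suc k) + phaseStart (suc k) ≤ 2 * n
  double-start≤2n = subst (phaseStart (suc k) + phaseStart (suc k) ≤_) (cong (n +_) (sym (+-identityʳ n)))
                          (+-mono-≤ start≤n start≤n)
  2n<pos-y : 2 * n < pos y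
  2n<pos-y = subst (2 * n <_) (sym (pos-toCopy (f n))) (f>2x n N≤n)
  start≤⌊y/2⌋ : phaseStart (suc k) ≤ ⌊ y /2⌋
  start≤⌊y/2⌋ = ≮⇒≥ λ ⌊y/2⌋<start →
    <-asym 2n<pos-y (<-≤-trans (pos<double-start (suc k) y ⌊y/2⌋<start) double-start≤2n)
  ack<y : ack k (phaseStart k) < y
  ack<y = ≤-trans (s≤s (ack≤phaseEnd k)) (≤-trans start≤⌊y/2⌋ (⌊n/2⌋≤n y))
  a≡cell1 : a ≡ cell (phaseStart k) 1
  a≡cell1 = cong (cell (phaseStart k)) (lsb[1+cell[i,0]] (M + N))
  y<ack : y < ack k (phaseStart k)
  y<ack = <-≤-trans (subst (λ x → imageFun copy f x < ack M (phaseStart k)) (sym a≡cell1) (below (phaseStart k)))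
                    (ack-monoˡ-≤ _ (≤-trans (m≤m+n M N) M+N≤k))

image-not-PR : ∀ f → EventuallyAboveDouble f → ¬ IsPR₁ (imageFun copy f)
image-not-PR f above (p , p≗fᴬ) = image-not-below-ack f above M below
  where
  fᴬ : PRFun 1
  fᴬ = prfun p (λ xs → imageFun copy f (head xs)) (λ { (x ∷ []) → p≗fᴬ x })
  G : PRFun 1
  G = fᴬ ⟨ cellₚ (π (# 0)) (constₚ 1) ∷ [] ⟩
  M = proj₁ (eval-belowAck (code G))
  below : ∀ s → imageFun copy f (cell s 1) < ack M s
  below s = subst₂ _<_ (eval-code G (s ∷ [])) (cong (ack M) (⊔-identityʳ s))
                       (proj₂ (eval-belowAck (code G)) (s ∷ []))

mainTheorem2 : Σ (ℕ → ℕ) λ SA → Σ (ℕ ↔ ℕ) λ c →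
    IsIsoToCopy SA c × IsPR₁ SA × IsPRRel₂ (imageRel c _≤_) ×
    (∀ f → IsPR₁ f → EventuallyAboveDouble f → ¬ IsPR₁ (imageFun c f))
mainTheorem2 = succA , copy , (λ n → refl) , isPR₁ succAₚ succA succAₚ-correct , ≤-isPR-on-copy ,
  λ f _ → image-not-PR f
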